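{- For every integer $n\ge 3$ there is an oriented graph $G$ on $n$ vertices with minimum semi-degree $\delta^0(G)=\lceil (3n-4)/8\rceil -1$ which does not contain a $1$-factor, and hence does not contain a Hamilton cycle.
   Context: An oriented graph is a directed graph obtained from a simple undirected graph by orienting each of its edges. The minimum semi-degree $\delta^0(G)$ is the minimum of the minimum outdegree and the minimum indegree of $G$. A $1$-factor of a digraph is a collection of vertex-disjoint directed cycles covering all vertices. A Hamilton cycle is a directed cycle containing all vertices. -}

module Defs where

open import Data.Nat using (ℕ; _+_; _*_; _∸_; _≤_; _/_)
open import Data.Bool using (Bool; true; false; T)
open import Data.Fin using (Fin)
open import Data.List using (List; []; _∷_; _++_; length; allFin; filterᵇ; concat)
open import Data.List.Relation.Unary.All using (All)
open import Data.List.Relation.Unary.Linked using (Linked)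
open import Data.List.Relation.Unary.Unique.Propositional using (Unique)
open import Data.List.Relation.Binary.Permutation.Propositional using (_↭_)
open import Data.Product using (Σ; _×_; ∃)
open import Data.Sum using (_⊎_)
open import Relation.Binary.PropositionalEquality using (_≡_)
open import Relation.Nullary using (¬_)

Digraph : ℕ → Set
Digraph n = Fin n → Fin n → Bool

Arc : ∀ {n} → Digraph n → Fin n → Fin n → Set
Arc G u v = T (G u v)

IsOriented : ∀ {n} → Digraph n → Set
IsOriented {n} G = (∀ (v : Fin n) → ¬ Arc G v v) × (∀ (u v : Fin n) → ¬ (Arc G u v × Arc G v u))

outdeg : ∀ {n} → Digraph n → Fin n → ℕ
outdeg {n} G u = length (filterᵇ (λ v → G u v) (allFin n))

indeg : ∀ {n} → Digraph n → Fin n → ℕ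
indeg {n} G v = length (filterᵇ (λ u → G u v) (allFin n))

MinSemiDegree : ∀ {n} → Digraph n → ℕ → Set
MinSemiDegree {n} G d =
  (∀ (v : Fin n) → d ≤ outdeg G v × d ≤ indeg G v) ×
  (∃ λ (v : Fin n) → outdeg G v ≡ d ⊎ indeg G v ≡ d)

IsCycle : ∀ {n} → Digraph n → List (Fin n) → Set
IsCycle {n} G c =
  Σ (Fin n) λ v → Σ (List (Fin n)) λ rest →
    (c ≡ v ∷ rest) × (1 ≤ length rest) × Unique c ×
    Linked (Arc G) (v ∷ rest ++ v ∷ [])

-- A 1-factor: a collection of directed cycles which are vertex-disjoint and
-- cover all vertices (every vertex occurs exactly once among the cycles).
Has1Factor : ∀ {n} → Digraph n → Set
Has1Factor {n} G = Σ (List (List (Fin n))) λ cs → All (IsCycle G) cs × (concat cs ↭ allFin n)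

HasHamiltonCycle : ∀ {n} → Digraph n → Set
HasHamiltonCycle {n} G = Σ (List (Fin n)) λ c → IsCycle G c × (c ↭ allFin n)

ceilDiv8 : ℕ → ℕ
ceilDiv8 a = (a + 7) / 8

-- Split the vertices into classes A, B, C, D with |D| = |B| + 1 and orient so that every arc
-- leaving A ∪ D ends in A ∪ B.  A 1-factor maps each vertex to its successor injectively, so it
-- would inject A ∪ D into A ∪ B, which is impossible as |A ∪ D| = |A ∪ B| + 1.  The digraphs are
-- given by a vertex ordering and a label per vertex; whether u → v is an arc depends only on the
-- two labels and on which vertex comes first.  Prepending a fixed block of eight labelled vertices
-- raises every out- and in-degree by at least three, preserves |D| = |B| + 1, and keeps the
-- minimum attained, matching δ⁰(n + 8) = δ⁰(n) + 3; the eight cases 3 ≤ n ≤ 10 are decided by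
-- computation.
module Submission where

open import Defs
open import Algebra.Properties.CommutativeSemigroup using (x∙yz≈y∙xz)
open import Data.Bool using (Bool; true; false; T; not; _∧_; _∨_; _xor_; if_then_else_)
open import Data.Empty using (⊥-elim)
open import Data.Fin using (Fin; zero; suc; _↑ˡ_; _↑ʳ_)
open import Data.Fin.Properties using (all?; any?)
import Data.List as List
open import Data.List using (List; []; _∷_; _∷ʳ_; length; filterᵇ; tabulate; allFin; concat)
open import Data.List.Membership.Propositional using (_∈_)
open import Data.List.Properties using (length-++; filter-++; ++-identityʳ)
open import Data.List.Relation.Binary.Permutation.Propositional using (_↭_; ↭-sym)
open import Data.List.Relation.Binary.Permutation.Propositional.Properties
  using (↭-length; filter-↭; ∷↭∷ʳ)
import Data.List.Relation.Unary.All as All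
open import Data.List.Relation.Unary.All using (All; []; _∷_)
open import Data.List.Relation.Unary.Any using (here; there)
open import Data.List.Relation.Unary.Linked using (Linked; [-]; _∷_)
open import Data.Nat using (ℕ; zero; suc; _+_; _*_; _∸_; _/_; _≤_; _<_; z≤n; s≤s; _≤?_; _≟_)
open import Data.Nat.DivMod using (+-distrib-/-∣ˡ)
open import Data.Nat.Divisibility using (divides)
open import Data.Nat.Properties
  using (+-assoc; +-comm; *-distribˡ-+; +-mono-≤; ≤-reflexive; m≤n⇒m≤1+n; <⇒≱; +-commutativeSemigroup)
open import Data.Product using (Σ; ∃; _×_; _,_; proj₁; proj₂)
open import Data.Sum using (_⊎_; inj₁)
open import Data.Unit using (tt)
open import Data.Vec.Functional using (_++_)
open import Data.Vec.Functional.Properties using (lookup-++ˡ; lookup-++ʳ)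
open import Function using (_∘_)
open import Relation.Binary.PropositionalEquality
  using (_≡_; refl; sym; trans; cong; cong₂; subst; subst₂; module ≡-Reasoning)
open import Relation.Nullary using (¬_)
open import Relation.Nullary.Decidable
  using (Dec; True; T?; map′; from-yes; toWitness; _×-dec_; _→-dec_)
open import Relation.Unary using (Decidable)

open ≡-Reasoning

count : ∀ {n} → (Fin n → Bool) → ℕ
count {zero}  p = 0
count {suc n} p = (if p zero then 1 else 0) + count (p ∘ suc)

count-cong : ∀ {n} {p q : Fin n → Bool} → (∀ i → p i ≡ q i) → count p ≡ count q
count-cong {zero}  eq = refl
count-cong {suc n} eq = cong₂ (λ b c → (if b then 1 else 0) + c) (eq zero) (count-cong (eq ∘ suc))

count-↑ : ∀ m {n} (p : Fin (m + n) → Bool) → count p ≡ count (p ∘ (_↑ˡ n)) + count (p ∘ (m ↑ʳ_))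
count-↑ zero        p = refl
count-↑ (suc m) {n} p =
  trans (cong (b +_) (count-↑ m (p ∘ suc))) (sym (+-assoc b (count (p ∘ suc ∘ (_↑ˡ n))) _))
  where b = if p zero then 1 else 0

length-filterᵇ-tabulate : ∀ {A : Set} {n} (p : A → Bool) (f : Fin n → A) →
                          length (filterᵇ p (tabulate f)) ≡ count (p ∘ f)
length-filterᵇ-tabulate {n = zero}  p f = refl
length-filterᵇ-tabulate {n = suc n} p f with p (f zero)
... | true  = cong suc (length-filterᵇ-tabulate p (f ∘ suc))
... | false = length-filterᵇ-tabulate p (f ∘ suc)

outdegᶜ indegᶜ : ∀ {n} → Digraph n → Fin n → ℕ
outdegᶜ G u = count (G u)
indegᶜ  G v = count (λ u → G u v)

outdeg≡outdegᶜ : ∀ {n} (G : Digraph n) u → outdeg G u ≡ outdegᶜ G u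
outdeg≡outdegᶜ G u = length-filterᵇ-tabulate (G u) (λ v → v)

indeg≡indegᶜ : ∀ {n} (G : Digraph n) v → indeg G v ≡ indegᶜ G v
indeg≡indegᶜ G v = length-filterᵇ-tabulate (λ u → G u v) (λ u → u)

hamilton⇒1-factor : ∀ {n} {G : Digraph n} → HasHamiltonCycle G → Has1Factor G
hamilton⇒1-factor {n} (c , cycle , c↭V) =
  c ∷ [] , cycle ∷ [] , subst (_↭ allFin n) (sym (++-identityʳ c)) c↭V

module _ {n} (G : Digraph n) {X Y : Fin n → Bool}
         (closed : ∀ {u v} → Arc G u v → T (X u) → T (Y v)) where

  private
    countᴸ : (Fin n → Bool) → List (Fin n) → ℕ
    countᴸ p xs = length (filterᵇ p xs)

    countᴸ-++ : ∀ p xs ys → countᴸ p (xs List.++ ys) ≡ countᴸ p xs + countᴸ p ys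
    countᴸ-++ p xs ys = trans (cong length (filter-++ (T? ∘ p) xs ys)) (length-++ (filterᵇ p xs))

    countᴸ-↭ : ∀ p {xs ys} → xs ↭ ys → countᴸ p xs ≡ countᴸ p ys
    countᴸ-↭ p = ↭-length ∘ filter-↭ (T? ∘ p)

    countᴸ-∷-mono : ∀ {x y xs ys} → (T (X x) → T (Y y)) → countᴸ X xs ≤ countᴸ Y ys →
                    countᴸ X (x ∷ xs) ≤ countᴸ Y (y ∷ ys)
    countᴸ-∷-mono {x} {y} x→y le with X x | Y y
    ... | true  | true  = s≤s le
    ... | true  | false = ⊥-elim (x→y tt)
    ... | false | true  = m≤n⇒m≤1+n le
    ... | false | false = le

    countᴸ-path : ∀ u vs w → Linked (Arc G) (u ∷ vs ∷ʳ w) → countᴸ X (u ∷ vs) ≤ countᴸ Y (vs ∷ʳ w)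
    countᴸ-path u []       w (uw ∷ [-])  = countᴸ-∷-mono (closed uw) z≤n
    countᴸ-path u (v ∷ vs) w (uv ∷ path) = countᴸ-∷-mono (closed uv) (countᴸ-path v vs w path)

    countᴸ-cycle : ∀ {c} → IsCycle G c → countᴸ X c ≤ countᴸ Y c
    countᴸ-cycle (u , vs , refl , _ , _ , path) =
      subst (countᴸ X (u ∷ vs) ≤_) (countᴸ-↭ Y (↭-sym (∷↭∷ʳ u vs))) (countᴸ-path u vs u path)

    countᴸ-cycles : ∀ {cs} → All (IsCycle G) cs → countᴸ X (concat cs) ≤ countᴸ Y (concat cs)
    countᴸ-cycles {[]}     []               = z≤n
    countᴸ-cycles {c ∷ cs} (cycle ∷ cycles) =
      subst₂ _≤_ (sym (countᴸ-++ X c (concat cs))) (sym (countᴸ-++ Y c (concat cs)))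
             (+-mono-≤ (countᴸ-cycle cycle) (countᴸ-cycles cycles))

  1-factor⇒count≤ : Has1Factor G → count X ≤ count Y
  1-factor⇒count≤ (cs , cycles , cs↭V) = subst₂ _≤_ (count-V X) (count-V Y) (countᴸ-cycles cycles)
    where
    count-V : ∀ p → countᴸ p (concat cs) ≡ count p
    count-V p = trans (countᴸ-↭ p cs↭V) (length-filterᵇ-tabulate p (λ v → v))

  count<⇒¬1-factor : count Y < count X → ¬ Has1Factor G
  count<⇒¬1-factor Y<X = <⇒≱ Y<X ∘ 1-factor⇒count≤

_≺_ : ∀ {n} → Fin n → Fin n → Bool
zero  ≺ zero  = false
zero  ≺ suc _ = true
suc _ ≺ zero  = false
suc i ≺ suc j = i ≺ j

≺-irrefl : ∀ {n} (i : Fin n) → ¬ T (i ≺ i)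
≺-irrefl (suc i) = ≺-irrefl i

≺-asym : ∀ {n} (i j : Fin n) → T (i ≺ j) → ¬ T (j ≺ i)
≺-asym zero    (suc j) _ ()
≺-asym (suc i) (suc j) = ≺-asym i j

↑ˡ≺↑ˡ : ∀ {m} n (i k : Fin m) → (i ↑ˡ n) ≺ (k ↑ˡ n) ≡ i ≺ k
↑ˡ≺↑ˡ n zero    zero    = refl
↑ˡ≺↑ˡ n zero    (suc k) = refl
↑ˡ≺↑ˡ n (suc i) zero    = refl
↑ˡ≺↑ˡ n (suc i) (suc k) = ↑ˡ≺↑ˡ n i k

↑ʳ≺↑ʳ : ∀ m {n} (j k : Fin n) → (m ↑ʳ j) ≺ (m ↑ʳ k) ≡ j ≺ k
↑ʳ≺↑ʳ zero    j k = refl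
↑ʳ≺↑ʳ (suc m) j k = ↑ʳ≺↑ʳ m j k

↑ˡ≺↑ʳ : ∀ {m n} (i : Fin m) (j : Fin n) → (i ↑ˡ n) ≺ (m ↑ʳ j) ≡ true
↑ˡ≺↑ʳ zero    j = refl
↑ˡ≺↑ʳ (suc i) j = ↑ˡ≺↑ʳ i j

↑ʳ≺↑ˡ : ∀ {m n} (i : Fin m) (j : Fin n) → (m ↑ʳ j) ≺ (i ↑ˡ n) ≡ false
↑ʳ≺↑ˡ zero    j = refl
↑ʳ≺↑ˡ (suc i) j = ↑ʳ≺↑ˡ i j

↑-elim : ∀ m {n} {P : Fin (m + n) → Set} → (∀ i → P (i ↑ˡ n)) → (∀ j → P (m ↑ʳ j)) → ∀ u → P u
↑-elim zero    left right u       = right u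
↑-elim (suc m) left right zero    = left zero
↑-elim (suc m) left right (suc u) = ↑-elim m (left ∘ suc) right u

-- rule x y before after: is there an arc from an x-labelled vertex u to a y-labelled vertex v,
-- where before = u ≺ v and after = v ≺ u (both false exactly when u = v)?
module Labelled {L : Set} (rule : L → L → Bool → Bool → Bool) where

  labelled : ∀ {n} → (Fin n → L) → Digraph n
  labelled ℓ u v = rule (ℓ u) (ℓ v) (u ≺ v) (v ≺ u)

  outAfter outBefore inAfter inBefore : ∀ {n} → L → (Fin n → L) → ℕ
  outAfter  x ℓ = count λ j → rule x (ℓ j) true false
  outBefore x ℓ = count λ j → rule x (ℓ j) false true
  inAfter   x ℓ = count λ j → rule (ℓ j) x false true
  inBefore  x ℓ = count λ j → rule (ℓ j) x true false

  labelled-oriented : (∀ x y l r → T (rule x y l r) → T (rule y x r l) → T l × T r) →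
                      ∀ {n} (ℓ : Fin n → L) → IsOriented (labelled ℓ)
  labelled-oriented antisym ℓ = no-loop , no-digon
    where
    no-loop : ∀ u → ¬ Arc (labelled ℓ) u u
    no-loop u uu = ≺-irrefl u (proj₁ (antisym _ _ _ _ uu uu))
    no-digon : ∀ u v → ¬ (Arc (labelled ℓ) u v × Arc (labelled ℓ) v u)
    no-digon u v (uv , vu) with u≺v , v≺u ← antisym _ _ _ _ uv vu = ≺-asym u v u≺v v≺u

  module _ {m n} (β : Fin m → L) (ℓ : Fin n → L) where

    count-∘-++ : (p : L → Bool) → count (p ∘ (β ++ ℓ)) ≡ count (p ∘ β) + count (p ∘ ℓ)
    count-∘-++ p = trans (count-↑ m (p ∘ (β ++ ℓ)))
      (cong₂ _+_ (count-cong (cong p ∘ lookup-++ˡ β ℓ)) (count-cong (cong p ∘ lookup-++ʳ β ℓ)))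

    private
      G = labelled (β ++ ℓ)

      ↑ˡ↑ˡ : ∀ i k → G (i ↑ˡ n) (k ↑ˡ n) ≡ labelled β i k
      ↑ˡ↑ˡ i k rewrite lookup-++ˡ β ℓ i | lookup-++ˡ β ℓ k | ↑ˡ≺↑ˡ n i k | ↑ˡ≺↑ˡ n k i = refl

      ↑ˡ↑ʳ : ∀ i j → G (i ↑ˡ n) (m ↑ʳ j) ≡ rule (β i) (ℓ j) true false
      ↑ˡ↑ʳ i j rewrite lookup-++ˡ β ℓ i | lookup-++ʳ β ℓ j | ↑ˡ≺↑ʳ i j | ↑ʳ≺↑ˡ i j = refl

      ↑ʳ↑ˡ : ∀ j i → G (m ↑ʳ j) (i ↑ˡ n) ≡ rule (ℓ j) (β i) false true
      ↑ʳ↑ˡ j i rewrite lookup-++ˡ β ℓ i | lookup-++ʳ β ℓ j | ↑ˡ≺↑ʳ i j | ↑ʳ≺↑ˡ i j = refl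

      ↑ʳ↑ʳ : ∀ j k → G (m ↑ʳ j) (m ↑ʳ k) ≡ labelled ℓ j k
      ↑ʳ↑ʳ j k rewrite lookup-++ʳ β ℓ j | lookup-++ʳ β ℓ k | ↑ʳ≺↑ʳ m j k | ↑ʳ≺↑ʳ m k j = refl

    outdeg-++-↑ˡ : ∀ i → outdegᶜ G (i ↑ˡ n) ≡ outdegᶜ (labelled β) i + outAfter (β i) ℓ
    outdeg-++-↑ˡ i = trans (count-↑ m _) (cong₂ _+_ (count-cong (↑ˡ↑ˡ i)) (count-cong (↑ˡ↑ʳ i)))

    outdeg-++-↑ʳ : ∀ j → outdegᶜ G (m ↑ʳ j) ≡ outBefore (ℓ j) β + outdegᶜ (labelled ℓ) j
    outdeg-++-↑ʳ j = trans (count-↑ m _) (cong₂ _+_ (count-cong (↑ʳ↑ˡ j)) (count-cong (↑ʳ↑ʳ j)))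

    indeg-++-↑ˡ : ∀ i → indegᶜ G (i ↑ˡ n) ≡ indegᶜ (labelled β) i + inAfter (β i) ℓ
    indeg-++-↑ˡ i =
      trans (count-↑ m _) (cong₂ _+_ (count-cong (λ k → ↑ˡ↑ˡ k i)) (count-cong (λ j → ↑ʳ↑ˡ j i)))

    indeg-++-↑ʳ : ∀ j → indegᶜ G (m ↑ʳ j) ≡ inBefore (ℓ j) β + indegᶜ (labelled ℓ) j
    indeg-++-↑ʳ j =
      trans (count-↑ m _) (cong₂ _+_ (count-cong (λ i → ↑ˡ↑ʳ i j)) (count-cong (λ k → ↑ʳ↑ʳ k j)))

  module _ {m m′ n} (β : Fin m → L) (β′ : Fin m′ → L) (ℓ : Fin n → L) where

    outdeg-++-++-↑ˡ : ∀ i → outdegᶜ (labelled (β ++ (β′ ++ ℓ))) (i ↑ˡ _)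
                          ≡ outAfter (β i) β′ + outdegᶜ (labelled (β ++ ℓ)) (i ↑ˡ n)
    outdeg-++-++-↑ˡ i = begin
      outdegᶜ (labelled (β ++ (β′ ++ ℓ))) (i ↑ˡ _)
        ≡⟨ outdeg-++-↑ˡ β (β′ ++ ℓ) i ⟩
      outdegᶜ (labelled β) i + outAfter (β i) (β′ ++ ℓ)
        ≡⟨ cong (outdegᶜ (labelled β) i +_) (count-∘-++ β′ ℓ λ y → rule (β i) y true false) ⟩
      outdegᶜ (labelled β) i + (outAfter (β i) β′ + outAfter (β i) ℓ)
        ≡⟨ x∙yz≈y∙xz +-commutativeSemigroup (outdegᶜ (labelled β) i) (outAfter (β i) β′) _ ⟩
      outAfter (β i) β′ + (outdegᶜ (labelled β) i + outAfter (β i) ℓ)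
        ≡⟨ cong (outAfter (β i) β′ +_) (outdeg-++-↑ˡ β ℓ i) ⟨
      outAfter (β i) β′ + outdegᶜ (labelled (β ++ ℓ)) (i ↑ˡ n)
        ∎

    indeg-++-++-↑ˡ : ∀ i → indegᶜ (labelled (β ++ (β′ ++ ℓ))) (i ↑ˡ _)
                         ≡ inAfter (β i) β′ + indegᶜ (labelled (β ++ ℓ)) (i ↑ˡ n)
    indeg-++-++-↑ˡ i = begin
      indegᶜ (labelled (β ++ (β′ ++ ℓ))) (i ↑ˡ _)
        ≡⟨ indeg-++-↑ˡ β (β′ ++ ℓ) i ⟩
      indegᶜ (labelled β) i + inAfter (β i) (β′ ++ ℓ)
        ≡⟨ cong (indegᶜ (labelled β) i +_) (count-∘-++ β′ ℓ λ y → rule y (β i) false true) ⟩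
      indegᶜ (labelled β) i + (inAfter (β i) β′ + inAfter (β i) ℓ)
        ≡⟨ x∙yz≈y∙xz +-commutativeSemigroup (indegᶜ (labelled β) i) (inAfter (β i) β′) _ ⟩
      inAfter (β i) β′ + (indegᶜ (labelled β) i + inAfter (β i) ℓ)
        ≡⟨ cong (inAfter (β i) β′ +_) (indeg-++-↑ˡ β ℓ i) ⟨
      inAfter (β i) β′ + indegᶜ (labelled (β ++ ℓ)) (i ↑ˡ n)
        ∎

∀-enum? : ∀ {A : Set} {P : A → Set} (xs : List A) → (∀ x → x ∈ xs) → Decidable P → Dec (∀ x → P x)
∀-enum? xs complete P? =
  map′ (λ all x → All.lookup all (complete x)) (λ h → All.tabulate (λ {x} _ → h x)) (All.all? P? xs)

∀-Bool? : ∀ {P : Bool → Set} → Decidable P → Dec (∀ b → P b)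
∀-Bool? = ∀-enum? (true ∷ false ∷ []) λ { true → here refl ; false → there (here refl) }

data Class : Set where
  A B C D : Class

data Label : Set where
  a₀ a₁ b₀ b₁ b⋆ c₀ c₁ d₀ d₁ : Label

∀-Label? : ∀ {P : Label → Set} → Decidable P → Dec (∀ x → P x)
∀-Label? = ∀-enum? (a₀ ∷ a₁ ∷ b₀ ∷ b₁ ∷ b⋆ ∷ c₀ ∷ c₁ ∷ d₀ ∷ d₁ ∷ []) λ where
  a₀ → here refl
  a₁ → there (here refl)
  b₀ → there (there (here refl))
  b₁ → there (there (there (here refl)))
  b⋆ → there (there (there (there (here refl))))
  c₀ → there (there (there (there (there (here refl)))))
  c₁ → there (there (there (there (there (there (here refl))))))
  d₀ → there (there (there (there (there (there (there (here refl)))))))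
  d₁ → there (there (there (there (there (there (there (there (here refl))))))))

class : Label → Class
class a₀ = A
class a₁ = A
class b₀ = B
class b₁ = B
class b⋆ = B
class c₀ = C
class c₁ = C
class d₀ = D
class d₁ = D

parity : Label → Bool
parity a₁ = true
parity b₁ = true
parity c₁ = true
parity d₁ = true
parity _  = false

special : Label → Bool
special b⋆ = true
special _  = false

arc : Label → Label → Bool → Bool → Bool
arc x y before after = between (class x) (class y)
  where
  sameParity = not (parity x xor parity y)
  tournament = if sameParity then after else before
  between : Class → Class → Bool
  between A A = tournament
  between B B = tournament
  between C C = tournament
  between A B = true
  between B C = true
  between C D = true
  between D A = true
  between C A = true
  between D B = sameParity ∧ not (special y)
  between B D = not sameParity ∨ special x
  between _ _ = false

inA∪D inA∪B : Label → Bool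
inA∪D x with class x
... | A = true
... | D = true
... | _ = false
inA∪B x with class x
... | A = true
... | B = true
... | _ = false

arc-antisym : ∀ x y l r → T (arc x y l r) → T (arc y x r l) → T l × T r
arc-antisym = from-yes (∀-Label? λ x → ∀-Label? λ y → ∀-Bool? λ l → ∀-Bool? λ r →
  T? (arc x y l r) →-dec T? (arc y x r l) →-dec T? l ×-dec T? r)

arc-closed : ∀ x y l r → T (arc x y l r) → T (inA∪D x) → T (inA∪B y)
arc-closed = from-yes (∀-Label? λ x → ∀-Label? λ y → ∀-Bool? λ l → ∀-Bool? λ r →
  T? (arc x y l r) →-dec T? (inA∪D x) →-dec T? (inA∪B y))

open Labelled arc

block : Fin 8 → Label
block = List.lookup (a₀ ∷ a₁ ∷ b₀ ∷ b₁ ∷ c₀ ∷ c₁ ∷ d₀ ∷ d₁ ∷ [])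

block-gain : ∀ x → 3 ≤ outBefore x block × 3 ≤ inBefore x block
block-gain = from-yes (∀-Label? λ x → (3 ≤? outBefore x block) ×-dec (3 ≤? inBefore x block))

block-gain-self : ∀ p → 3 ≤ outAfter (block p) block × 3 ≤ inAfter (block p) block
block-gain-self = from-yes (all? λ p → (3 ≤? outAfter (block p) block) ×-dec (3 ≤? inAfter (block p) block))

-- The invariant carried through the induction: the vertices of one more block already have
-- degree at least d + 3, and the minimum d is attained at a vertex which each block raises by
-- exactly three.
record Good {n} (ℓ : Fin n → Label) (d : ℕ) : Set where
  field
    degrees            : ∀ u → d ≤ outdegᶜ (labelled ℓ) u × d ≤ indegᶜ (labelled ℓ) u
    next-block-degrees : ∀ p → 3 + d ≤ outdegᶜ (labelled (block ++ ℓ)) (p ↑ˡ n)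
                             × 3 + d ≤ indegᶜ (labelled (block ++ ℓ)) (p ↑ˡ n)
    surplus            : count (inA∪D ∘ ℓ) ≡ suc (count (inA∪B ∘ ℓ))
    tight              : ∃ λ u → outdegᶜ (labelled ℓ) u ≡ d × outBefore (ℓ u) block ≡ 3

good? : ∀ {n} (ℓ : Fin n → Label) d → Dec (Good ℓ d)
good? ℓ d =
  map′ (λ (a , b , c , e) → record { degrees = a ; next-block-degrees = b ; surplus = c ; tight = e })
       (λ g → Good.degrees g , Good.next-block-degrees g , Good.surplus g , Good.tight g)
       (all? (λ u → (d ≤? outdegᶜ (labelled ℓ) u) ×-dec (d ≤? indegᶜ (labelled ℓ) u))
        ×-dec all? (λ p → (3 + d ≤? outdegᶜ (labelled (block ++ ℓ)) (p ↑ˡ _))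
                          ×-dec (3 + d ≤? indegᶜ (labelled (block ++ ℓ)) (p ↑ˡ _)))
        ×-dec count (inA∪D ∘ ℓ) ≟ suc (count (inA∪B ∘ ℓ))
        ×-dec any? (λ u → (outdegᶜ (labelled ℓ) u ≟ d) ×-dec (outBefore (ℓ u) block ≟ 3)))

good-++ : ∀ {n} {ℓ : Fin n → Label} {d} → Good ℓ d → Good (block ++ ℓ) (3 + d)
good-++ {n} {ℓ} {d} g = record
  { degrees            = ↑-elim 8 next-block-degrees old-degrees
  ; next-block-degrees = new-degrees
  ; surplus            = cong (4 +_) surplus
  ; tight              = tight′
  }
  where
  open Good g

  old-degrees : ∀ j → 3 + d ≤ outdegᶜ (labelled (block ++ ℓ)) (8 ↑ʳ j)
                    × 3 + d ≤ indegᶜ (labelled (block ++ ℓ)) (8 ↑ʳ j)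
  old-degrees j =
    subst (3 + d ≤_) (sym (outdeg-++-↑ʳ block ℓ j)) (+-mono-≤ (proj₁ (block-gain (ℓ j))) (proj₁ (degrees j))) ,
    subst (3 + d ≤_) (sym (indeg-++-↑ʳ block ℓ j)) (+-mono-≤ (proj₂ (block-gain (ℓ j))) (proj₂ (degrees j)))

  new-degrees : ∀ p → 6 + d ≤ outdegᶜ (labelled (block ++ (block ++ ℓ))) (p ↑ˡ _)
                    × 6 + d ≤ indegᶜ (labelled (block ++ (block ++ ℓ))) (p ↑ˡ _)
  new-degrees p =
    subst (6 + d ≤_) (sym (outdeg-++-++-↑ˡ block block ℓ p))
          (+-mono-≤ (proj₁ (block-gain-self p)) (proj₁ (next-block-degrees p))) ,
    subst (6 + d ≤_) (sym (indeg-++-++-↑ˡ block block ℓ p))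
          (+-mono-≤ (proj₂ (block-gain-self p)) (proj₂ (next-block-degrees p)))

  tight′ : ∃ λ u → outdegᶜ (labelled (block ++ ℓ)) u ≡ 3 + d × outBefore ((block ++ ℓ) u) block ≡ 3
  tight′ with u , outdeg≡d , gain≡3 ← tight =
    8 ↑ʳ u ,
    trans (outdeg-++-↑ʳ block ℓ u) (cong₂ _+_ gain≡3 outdeg≡d) ,
    trans (cong (λ x → outBefore x block) (lookup-++ʳ block ℓ u)) gain≡3

good⇒counterexample : ∀ {n} {ℓ : Fin n → Label} {d} → Good ℓ d →
                      IsOriented (labelled ℓ) × MinSemiDegree (labelled ℓ) d ×
                      ¬ Has1Factor (labelled ℓ) × ¬ HasHamiltonCycle (labelled ℓ)
good⇒counterexample {ℓ = ℓ} {d} g =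
  labelled-oriented arc-antisym ℓ , (min-degrees , attained) , no-1-factor , no-1-factor ∘ hamilton⇒1-factor
  where
  open Good g
  G = labelled ℓ

  min-degrees : ∀ v → d ≤ outdeg G v × d ≤ indeg G v
  min-degrees v = subst (d ≤_) (sym (outdeg≡outdegᶜ G v)) (proj₁ (degrees v)) ,
                  subst (d ≤_) (sym (indeg≡indegᶜ G v)) (proj₂ (degrees v))

  attained : ∃ λ v → outdeg G v ≡ d ⊎ indeg G v ≡ d
  attained with u , outdeg≡d , _ ← tight = u , inj₁ (trans (outdeg≡outdegᶜ G u) outdeg≡d)

  no-1-factor : ¬ Has1Factor G
  no-1-factor = count<⇒¬1-factor G (arc-closed _ _ _ _) (≤-reflexive (sym surplus))

δ : ℕ → ℕ
δ n = ceilDiv8 (3 * n ∸ 4) ∸ 1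

δ-3+ : ∀ k → δ (3 + k) ≡ (4 + 3 * k) / 8
δ-3+ k = begin
  ((3 * (3 + k) ∸ 4) + 7) / 8 ∸ 1 ≡⟨ cong (λ t → ((t ∸ 4) + 7) / 8 ∸ 1) (*-distribˡ-+ 3 3 k) ⟩
  ((5 + 3 * k) + 7) / 8 ∸ 1       ≡⟨ cong (λ t → t / 8 ∸ 1) (+-comm (5 + 3 * k) 7) ⟩
  (8 + (4 + 3 * k)) / 8 ∸ 1       ≡⟨ cong (_∸ 1) (+-distrib-/-∣ˡ (4 + 3 * k) {d = 8} (divides 1 refl)) ⟩
  (4 + 3 * k) / 8                 ∎

δ-+8 : ∀ k → δ (8 + (3 + k)) ≡ 3 + δ (3 + k)
δ-+8 k = begin
  δ (3 + (8 + k))        ≡⟨ δ-3+ (8 + k) ⟩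
  (4 + 3 * (8 + k)) / 8  ≡⟨ cong (λ t → (4 + t) / 8) (*-distribˡ-+ 3 8 k) ⟩
  (24 + (4 + 3 * k)) / 8 ≡⟨ +-distrib-/-∣ˡ (4 + 3 * k) {d = 8} (divides 3 refl) ⟩
  3 + (4 + 3 * k) / 8    ≡⟨ cong (3 +_) (δ-3+ k) ⟨
  3 + δ (3 + k)          ∎

labelling-checked : (xs : List Label) → {True (good? (List.lookup xs) (δ (length xs)))} →
                    Σ (Fin (length xs) → Label) λ ℓ → Good ℓ (δ (length xs))
labelling-checked xs {ok} = List.lookup xs , toWitness ok

good-labelling : ∀ n → 3 ≤ n → Σ (Fin n → Label) λ ℓ → Good ℓ (δ n)
good-labelling 1  (s≤s ())
good-labelling 2  (s≤s (s≤s ()))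
good-labelling 3  _ = labelling-checked (a₀ ∷ c₀ ∷ d₀ ∷ [])
good-labelling 4  _ = labelling-checked (a₀ ∷ c₀ ∷ c₁ ∷ d₀ ∷ [])
good-labelling 5  _ = labelling-checked (a₀ ∷ b₀ ∷ c₀ ∷ d₀ ∷ d₁ ∷ [])
good-labelling 6  _ = labelling-checked (a₀ ∷ b₀ ∷ c₀ ∷ c₁ ∷ d₀ ∷ d₁ ∷ [])
good-labelling 7  _ = labelling-checked (a₀ ∷ b₀ ∷ b₁ ∷ c₀ ∷ d₀ ∷ d₁ ∷ d₀ ∷ [])
good-labelling 8  _ = labelling-checked (a₀ ∷ b₀ ∷ b₁ ∷ c₀ ∷ c₁ ∷ d₀ ∷ d₁ ∷ d₀ ∷ [])
good-labelling 9  _ = labelling-checked (a₀ ∷ b₀ ∷ b₁ ∷ c₀ ∷ c₁ ∷ c₀ ∷ d₀ ∷ d₁ ∷ d₀ ∷ [])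
good-labelling 10 _ = labelling-checked (a₀ ∷ a₁ ∷ b⋆ ∷ b₁ ∷ b₀ ∷ c₀ ∷ d₀ ∷ d₁ ∷ d₀ ∷ d₁ ∷ [])
good-labelling (suc (suc (suc (suc (suc (suc (suc (suc n@(suc (suc (suc k))))))))))) _
  with ℓ , good ← good-labelling n (s≤s (s≤s (s≤s z≤n))) =
  block ++ ℓ , subst (Good (block ++ ℓ)) (sym (δ-+8 k)) (good-++ good)

proposition3p1 : (n : ℕ) → 3 ≤ n →
    Σ (Digraph n) λ G → IsOriented G ×
      MinSemiDegree G (ceilDiv8 (3 * n ∸ 4) ∸ 1) ×
      ¬ Has1Factor G × ¬ HasHamiltonCycle G
proposition3p1 n 3≤n with ℓ , good ← good-labelling n 3≤n = labelled ℓ , good⇒counterexample good
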